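{- Let $\Pi$ be a ground HEX-program and $\mathbf{A}$ an interpretation. Let $\mathcal{C}$ be the partition of the set $A(\Pi)$ of ordinary atoms occurring in $\Pi$ into subset-maximal strongly connected components of the graph with edge relation $\rightarrow\cup\rightarrow_e$, and for $C\in\mathcal{C}$ let $\Pi_C=\{r\in\Pi\mid H(r)\cap C\neq\emptyset\}$. If $C\in\mathcal{C}$ and $U$ is an unfounded set of $\Pi_C$ with respect to $\mathbf{A}$ such that $U\subseteq C$, then $U$ is an unfounded set of $\Pi$ with respect to $\mathbf{A}$.
   Context: A ground HEX-program $\Pi$ is a finite set of rules $a_1\lor\cdots\lor a_k \leftarrow b_1,\dots,b_m,\mathit{not}\, b_{m+1},\dots,\mathit{not}\, b_n$ ($k+n>0$), where each $a_i$ is an ordinary ground atom and each $b_j$ is either an ordinary ground atom or a ground external atom $\&g[p_1,\dots,p_k](c_1,\dots,c_l)$ with constant input parameters $p_i$ (predicate names or object constants) and constant outputs $c_j$. For a rule $r$: $H(r)=\{a_1,\dots,a_k\}$, $B(r)$ the set of body literals, $B^+(r)=\{b_1,\dots,b_m\}$, $B^-(r)=\{b_{m+1},\dots,b_n\}$. An interpretation is a complete consistent assignment of truth values to ordinary ground atoms. Each external predicate $\&g$ has a Boolean oracle $f_{\&g}(\mathbf{A},\vec p,\vec c)$; $\mathbf{A}\models \&g[\vec p](\vec c)$ iff $f_{\&g}(\mathbf{A},\vec p,\vec c)=1$; ordinary atoms are satisfied iff true; $\mathbf{A}\models\mathit{not}\,b$ iff $\mathbf{A}\not\models b$. For a set $X$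 of atoms, $\mathbf{A}\,\dot\cup\neg.\,X$ is the interpretation agreeing with $\mathbf{A}$ except that all atoms of $X$ are false. For a program $P$ and interpretation $\mathbf{A}$, a set $X$ of ordinary ground atoms appearing in $P$ is an unfounded set of $P$ w.r.t. $\mathbf{A}$ iff for every rule $r\in P$ with $H(r)\cap X\neq\emptyset$ at least one holds: (i) some literal of $B(r)$ is false w.r.t. $\mathbf{A}$; (ii) some literal of $B(r)$ is false w.r.t. $\mathbf{A}\,\dot\cup\neg.\,X$; (iii) some atom of $H(r)\setminus X$ is true in $\mathbf{A}$. Dependencies over ground atoms: $p(\vec c)\rightarrow q(\vec d)$ iff some rule $r\in\Pi$ has $p(\vec c)\in H(r)$ and $q(\vec d)\in B^+(r)$; $p(\vec c)\rightarrow_e q(\vec d)$ iff some rule $r\in\Pi$ has $p(\vec c)\in H(r)$ and some external atom $\&g[q_1,\dots,q_n](\vec e)\in B^+(r)\cup B^-(r)$ with $q_i=q$ for some $i$. -}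

module Defs where

open import Data.Nat using (ℕ; _+_; _>_)
open import Data.Bool using (Bool; true; false; if_then_else_)
open import Data.List using (List; []; _∷_; _++_; concatMap; filter; length; map)
open import Data.List.Relation.Unary.Any using (any?)
open import Data.Product using (_×_; Σ; ∃; ∃-syntax; _,_; proj₁)
open import Data.Sum using (_⊎_)
open import Relation.Nullary using (¬_; does)
open import Relation.Binary.PropositionalEquality using (_≡_)
open import Relation.Binary.Construct.Closure.ReflexiveTransitive using (Star)
import Data.Nat.Properties as ℕP
import Data.List.Properties as LP
import Data.Product.Properties as PP
open import Relation.Binary using (DecidableEquality)
import Data.List.Membership.DecPropositional as DecMem
open import Data.List.Membership.Propositional using (_∈_; _∉_)

-- Ordinary ground atom p(c₁,…,cₙ): predicate name (a constant) and argument constants.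
Atom : Set
Atom = ℕ × List ℕ

pred : Atom → ℕ
pred = proj₁

_≟ᴬ_ : DecidableEquality Atom
_≟ᴬ_ = PP.≡-dec ℕP._≟_ (LP.≡-dec ℕP._≟_)

open DecMem _≟ᴬ_ using (_∈?_)

data Param : Set where
  predP  : ℕ → Param
  constP : ℕ → Param

-- Body atoms: ordinary atoms or ground external atoms &g[p₁,…,pₖ](c₁,…,cₗ).
data BAtom : Set where
  ord : Atom → BAtom
  ext : (g : ℕ) → (ins : List Param) → (outs : List ℕ) → BAtom

-- Rule  a₁ ∨ … ∨ aₖ ← b₁,…,bₘ, not bₘ₊₁, …, not bₙ
record Rule : Set where
  constructor mkRule
  field
    head : List Atom
    pos  : List BAtom
    neg  : List BAtom
open Rule public

WellFormedRule : Rule → Set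
WellFormedRule r = length (head r) + (length (pos r) + length (neg r)) > 0

Program : Set
Program = List Rule

Interp : Set
Interp = Atom → Bool

-- Oracles f_&g(A, p⃗, c⃗) for all external predicate names g.
Oracles : Set
Oracles = ℕ → Interp → List Param → List ℕ → Bool

Sat : Oracles → Interp → BAtom → Set
Sat O A (ord a)          = A a ≡ true
Sat O A (ext g ins outs) = O g A ins outs ≡ true

SomeBodyLitFalse : Oracles → Interp → Rule → Set
SomeBodyLitFalse O A r =
  (∃[ b ] (b ∈ pos r × ¬ Sat O A b)) ⊎ (∃[ b ] (b ∈ neg r × Sat O A b))

-- A ∪̇ ¬.X : agree with A except all atoms of X are false
_∸ᴵ_ : Interp → List Atom → Interp
(A ∸ᴵ X) a = if does (a ∈? X) then false else A a

ordAtoms : List BAtom → List Atom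
ordAtoms [] = []
ordAtoms (ord a ∷ bs) = a ∷ ordAtoms bs
ordAtoms (ext _ _ _ ∷ bs) = ordAtoms bs

ruleAtoms : Rule → List Atom
ruleAtoms r = head r ++ ordAtoms (pos r) ++ ordAtoms (neg r)

atoms : Program → List Atom
atoms P = concatMap ruleAtoms P

_⊆_ : List Atom → List Atom → Set
X ⊆ Y = ∀ {a} → a ∈ X → a ∈ Y

Unfounded : Oracles → Program → Interp → List Atom → Set
Unfounded O P A X =
  X ⊆ atoms P ×
  (∀ r → r ∈ P → (∃[ a ] (a ∈ head r × a ∈ X)) →
     SomeBodyLitFalse O A r
     ⊎ SomeBodyLitFalse O (A ∸ᴵ X) r
     ⊎ (∃[ a ] (a ∈ head r × a ∉ X × A a ≡ true)))

Dep : Program → Atom → Atom → Set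
Dep P a b = ∃[ r ] (r ∈ P × a ∈ head r × ord b ∈ pos r)

DepE : Program → Atom → Atom → Set
DepE P a b = ∃[ r ] (r ∈ P × a ∈ head r ×
  ∃[ g ] ∃[ ins ] ∃[ outs ]
    ((ext g ins outs ∈ pos r ⊎ ext g ins outs ∈ neg r) × predP (pred b) ∈ ins))

Edge : Program → Atom → Atom → Set
Edge P a b = Dep P a b ⊎ DepE P a b

Reach : Program → Atom → Atom → Set
Reach P = Star (Edge P)

StronglyConnected : Program → List Atom → Set
StronglyConnected P D = ∀ {a b} → a ∈ D → b ∈ D → Reach P a b

IsSCC : Program → List Atom → Set
IsSCC P C =
  (∃[ a ] (a ∈ C)) ×
  C ⊆ atoms P ×
  StronglyConnected P C ×
  (∀ D → D ⊆ atoms P → StronglyConnected P D → C ⊆ D → D ⊆ C)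

restrict : Program → List Atom → Program
restrict P C = filter (λ r → any? (_∈? C) (head r)) P

-- Whether X is unfounded for a program depends only on (a) X consisting of
-- atoms of the program and (b) the rules whose head meets X.  Hence:
--
-- For the theorem, U ⊆ C ⊆ A(Π) because C is a component of the graph on
-- A(Π); the rules of Π relevant for U all lie in Π_C, so transfer applies.
module Submission where

open import Defs
open import Data.List using (List)
open import Data.List.Relation.Unary.All using (All)
open import Data.List.Relation.Unary.Any as Any using (Any; any?)
open import Data.List.Membership.Propositional using (_∈_)
open import Data.List.Membership.DecPropositional _≟ᴬ_ using (_∈?_)
open import Data.List.Membership.Propositional.Properties using (∈-filter⁺)
open import Data.Product using (∃-syntax; _×_; _,_)
open import Relation.Binary.PropositionalEquality using (refl)

HeadMeets : Rule → List Atom → Set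
HeadMeets r X = ∃[ a ] (a ∈ head r × a ∈ X)

headMeets-mono : ∀ r {X Y} → X ⊆ Y → HeadMeets r X → HeadMeets r Y
headMeets-mono _ X⊆Y (a , a∈H , a∈X) = a , a∈H , X⊆Y a∈X

headMeets⇒Any : ∀ r C → HeadMeets r C → Any (_∈ C) (head r)
headMeets⇒Any _ _ (a , a∈H , a∈C) = Any.map (λ { refl → a∈C }) a∈H

restrict-contains : ∀ {P} r C → r ∈ P → HeadMeets r C → r ∈ restrict P C
restrict-contains r C r∈P meets =
  ∈-filter⁺ (λ s → any? (_∈? C) (head s)) r∈P (headMeets⇒Any r C meets)

-- Unfoundedness only inspects rules whose head meets X, so it transfers
-- from Q to P once those rules of P all belong to Q.
unfounded-transfer : ∀ O (P Q : Program) A X →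
  X ⊆ atoms P →
  (∀ r → r ∈ P → HeadMeets r X → r ∈ Q) →
  Unfounded O Q A X → Unfounded O P A X
unfounded-transfer O P Q A X X⊆P relevant∈Q (_ , unfoundedQ) =
  X⊆P , λ r r∈P meets → unfoundedQ r (relevant∈Q r r∈P meets) meets

proposition4 : (O : Oracles) (Π : Program) → All WellFormedRule Π →
    (A : Interp) (C U : List Atom) → IsSCC Π C →
    Unfounded O (restrict Π C) A U → U ⊆ C → Unfounded O Π A U
proposition4 O Π _ A C U (_ , C⊆atoms , _ , _) unfoundedΠC U⊆C =
  unfounded-transfer O Π (restrict Π C) A U U⊆atoms relevant∈ΠC unfoundedΠC
  where
    U⊆atoms : U ⊆ atoms Π
    U⊆atoms a∈U = C⊆atoms (U⊆C a∈U)

    relevant∈ΠC : ∀ r → r ∈ Π → HeadMeets r U → r ∈ restrict Π C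
    relevant∈ΠC r r∈Π meets = restrict-contains r C r∈Π (headMeets-mono r U⊆C meets)
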